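{- For an integer $m\ge1$ let $X_m$ be the set of elements $x$ of the symmetric group $S_m$ with $x^5=1$. Then for every integer $n>3$: (i) $|X_{2n}|=\sum_{\substack{n/5\le k\le n\\ n-k\text{ even}}}\frac{(2n)!}{\left(\frac{5k-n}{2}\right)!\left(\frac{n-k}{2}\right)!\,5^{\frac{n-k}{2}}}$; (ii) $2(2n)(2n-1)(2n-2)\,|X_{2n-3}|=\sum_{\substack{n/5\le k<n\\ n-k\text{ odd}}}\frac{2\,(2n)!}{\left(\frac{5k-n-1}{2}\right)!\left(\frac{n-k-1}{2}\right)!\,5^{\frac{n-k-1}{2}}}$, where $k$ ranges over integers. -}

module Defs where

open import Data.Nat using (ℕ; zero; suc; _+_; _*_; _∸_; _^_; _≤_; _<_; _≤ᵇ_; NonZero)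
open import Data.Nat.Base using (_!; _/_; _%_)
open import Data.Nat.Properties using (m*n≢0; m^n≢0; _!≢0)
open import Data.Bool using (Bool; true; false; if_then_else_; _∧_)
open import Data.Nat using (_≡ᵇ_)
open import Data.Fin using (Fin)
open import Data.Fin.Permutation using (Permutation′; _⟨$⟩ʳ_; _∘ₚ_; id)
open import Data.List using (List; map; upTo)
open import Data.Nat.ListAction using (sum)
open import Data.Product using (Σ; ∃; _×_; Σ-syntax)
open import Relation.Binary.PropositionalEquality using (_≡_)

_≈ₚ_ : {m : ℕ} → Permutation′ m → Permutation′ m → Set
_≈ₚ_ {m} x y = (i : Fin m) → x ⟨$⟩ʳ i ≡ y ⟨$⟩ʳ i

_^ₚ_ : {m : ℕ} → Permutation′ m → ℕ → Permutation′ m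
x ^ₚ zero  = id
x ^ₚ suc k = x ∘ₚ (x ^ₚ k)

InX : (m : ℕ) → Permutation′ m → Set
InX m x = (x ^ₚ 5) ≈ₚ id

CardX : (m N : ℕ) → Set
CardX m N =
  Σ[ e ∈ (Fin N → Permutation′ m) ]
    ( ((i : Fin N) → InX m (e i))
    × ((i j : Fin N) → e i ≈ₚ e j → i ≡ j)
    × ((x : Permutation′ m) → InX m x → Σ[ i ∈ Fin N ] (e i ≈ₚ x)) )

term : (M a b : ℕ) → ℕ
term M a b = _/_ (M !) ((a ! * b !) * 5 ^ b)
  {{m*n≢0 (a ! * b !) (5 ^ b) {{m*n≢0 (a !) (b !) {{a !≢0}} {{b !≢0}}}} {{m^n≢0 5 b}}}}

sumTo : ℕ → (ℕ → ℕ) → ℕ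
sumTo n f = sum (map f (upTo (suc n)))

summand₁ : ℕ → ℕ → ℕ
summand₁ n k =
  if (n ≤ᵇ 5 * k) ∧ (k ≤ᵇ n) ∧ (((n ∸ k) % 2) ≡ᵇ 0)
  then term (2 * n) ((5 * k ∸ n) / 2) ((n ∸ k) / 2)
  else 0

summand₂ : ℕ → ℕ → ℕ
summand₂ n k =
  if (n ≤ᵇ 5 * k) ∧ (suc k ≤ᵇ n) ∧ (((n ∸ k) % 2) ≡ᵇ 1)
  then 2 * term (2 * n) ((5 * k ∸ n ∸ 1) / 2) ((n ∸ k ∸ 1) / 2)
  else 0

-- An x ∈ S_m with x⁵ = 1 is a product of disjoint 5-cycles. Either x fixes the point 0 and is such an
-- element on the other m points, or 0 lies on a 5-cycle (0 a b c d), chosen in m(m−1)(m−2)(m−3) ways,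
-- and x is such an element on the remaining m − 4 points; hence
-- |X_{m+1}| = |X_m| + m(m−1)(m−2)(m−3) |X_{m−4}|. The numbers m! / ((m − 5j)! j! 5^j) of elements with
-- exactly j five-cycles satisfy the same recursion in m, so |X_m| is their sum over j. For m = 2n and
-- m = 2n − 3 the substitutions j = (n − k)/2 and j = (n − k − 1)/2 turn this sum into (i) and (ii).

module Submission where

open import Defs using (CardX; term; sumTo; summand₁; summand₂)
open import Data.Bool using (true; false; if_then_else_; _∧_)
open import Data.Empty using (⊥-elim)
open import Data.Fin using (Fin; zero; suc; punchIn; punchOut; splitAt; join; _↑ˡ_; _↑ʳ_; combine; remQuot)
open import Data.Fin.Permutation using (permutation; _⟨$⟩ʳ_)
open import Data.Fin.Properties
  using (_≟_; any?; suc-injective; splitAt-↑ˡ; splitAt-↑ʳ; join-splitAt; remQuot-combine; combine-remQuot;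
         punchIn-injective; punchInᵢ≢i; punchIn-punchOut)
open import Data.List using (List; []; _∷_; applyUpTo; map)
open import Data.List.Membership.Propositional using (_∈_)
open import Data.List.Relation.Unary.All using (All; []; _∷_; head)
open import Data.List.Relation.Unary.All.Properties using (All¬⇒¬Any; ¬All⇒Any¬)
open import Data.List.Relation.Unary.Any using (here; there)
import Data.List.Relation.Unary.Any as Any
open import Data.List.Relation.Unary.AllPairs using ([]; _∷_)
open import Data.List.Relation.Unary.Unique.Propositional using (Unique)
open import Data.Nat
  using (ℕ; zero; suc; _+_; _*_; _∸_; _^_; _!; _≤_; _<_; _≤ᵇ_; _≡ᵇ_; _/_; _%_; z≤n; s≤s; z<s; s<s)
open import Data.Nat.DivMod using (m*n/n≡m; m*n%n≡0; [m+kn]%n≡m%n)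
open import Data.Nat.GeneralisedArithmetic using (iterate)
open import Data.Nat.Induction using (<-rec)
open import Data.Nat.ListAction using (sum)
open import Data.Nat.Properties
  using (*-assoc; *-cancelˡ-<; *-cancelˡ-≤; *-comm; *-distribˡ-+; *-monoʳ-<; *-monoʳ-≤; *-monoˡ-≤; *-suc; *-zeroʳ;
         +-assoc; +-cancelʳ-<; +-cancelʳ-≤; +-cancelˡ-<; +-comm; +-identityʳ; +-monoʳ-<; +-monoʳ-≤; +-∸-assoc;
         <-trans; <-≤-trans; <⇒≤; m*n≢0; m^n≢0; _!≢0; m+n∸m≡n; m+n∸n≡m; m<n+m; m∸n≤m; m≤n*m; m≤n+m;
         m≤n+o⇒m∸n≤o; m≤n⇒m∸n≡0; m≤n⇒∃[o]m+o≡n; n<1+n; n∸n≡0; n≤1+n; ≤-<-connex; ≤-<-trans; ≤-pred;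
         ≤-refl; ≤-reflexive; ≤-total; ≤-trans; ≤ᵇ-reflects-≤; ≰⇒>; module ≤-Reasoning)
open import Data.Nat.Tactic.RingSolver using (solve-∀)
open import Data.Product using (Σ-syntax; _×_; _,_; proj₁; proj₂; uncurry)
open import Data.Sum using (_⊎_; inj₁; inj₂; [_,_]′)
open import Function using (_∘_)
open import Relation.Binary.Definitions using (Symmetric)
open import Relation.Binary.PropositionalEquality
  using (_≡_; _≢_; _≗_; refl; sym; trans; cong; cong₂; subst; subst₂; module ≡-Reasoning)
open import Relation.Nullary using (¬_; Dec; yes; no; ¬?)
open import Relation.Nullary.Decidable using (decidable-stable)
open import Relation.Nullary.Reflects using (Reflects; ofʸ; ofⁿ)

private
  variable
    A : Set
    n s K L : ℕ

Endo : ℕ → Set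
Endo n = Fin n → Fin n

record Enumeration {A : Set} (_≈_ : A → A → Set) (P : A → Set) (K : ℕ) : Set where
  field
    elem           : Fin K → A
    elem-∈         : ∀ i → P (elem i)
    elem-injective : ∀ i j → elem i ≈ elem j → i ≡ j
    elem-onto      : ∀ x → P x → Σ[ i ∈ Fin K ] elem i ≈ x

open Enumeration

Counts : (n : ℕ) → (Endo n → Set) → ℕ → Set
Counts n = Enumeration {Endo n} _≗_

module _ {_≈_ : A → A → Set} where

  Enumeration-cong : {P Q : A → Set} → (∀ x → P x → Q x) → (∀ x → Q x → P x) →
                     Enumeration _≈_ P K → Enumeration _≈_ Q K
  Enumeration-cong P⇒Q Q⇒P e = record
    { elem = elem e
    ; elem-∈ = λ i → P⇒Q _ (elem-∈ e i)
    ; elem-injective = elem-injective e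
    ; elem-onto = λ x q → elem-onto e x (Q⇒P x q)
    }

  Enumeration-⊎ : {P Q : A → Set} → Symmetric _≈_ → (∀ x y → P x → Q y → ¬ x ≈ y) →
                  Enumeration _≈_ P K → Enumeration _≈_ Q L →
                  Enumeration _≈_ (λ x → P x ⊎ Q x) (K + L)
  Enumeration-⊎ {K = K} {L = L} {P = P} {Q = Q} ≈-sym disjoint eP eQ = record
    { elem = elem′ ∘ splitAt K
    ; elem-∈ = elem′-∈ ∘ splitAt K
    ; elem-injective = λ i j eq →
        trans (sym (join-splitAt K L i))
              (trans (cong (join K L) (elem′-injective (splitAt K i) (splitAt K j) eq)) (join-splitAt K L j))
    ; elem-onto = onto
    }
    where
    elem′ : Fin K ⊎ Fin L → A
    elem′ (inj₁ i) = elem eP i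
    elem′ (inj₂ j) = elem eQ j

    elem′-∈ : ∀ u → P (elem′ u) ⊎ Q (elem′ u)
    elem′-∈ (inj₁ i) = inj₁ (elem-∈ eP i)
    elem′-∈ (inj₂ j) = inj₂ (elem-∈ eQ j)

    elem′-injective : ∀ u v → elem′ u ≈ elem′ v → u ≡ v
    elem′-injective (inj₁ i) (inj₁ j) eq = cong inj₁ (elem-injective eP i j eq)
    elem′-injective (inj₁ i) (inj₂ j) eq = ⊥-elim (disjoint _ _ (elem-∈ eP i) (elem-∈ eQ j) eq)
    elem′-injective (inj₂ i) (inj₁ j) eq = ⊥-elim (disjoint _ _ (elem-∈ eP j) (elem-∈ eQ i) (≈-sym eq))
    elem′-injective (inj₂ i) (inj₂ j) eq = cong inj₂ (elem-injective eQ i j eq)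

    onto : ∀ x → P x ⊎ Q x → Σ[ u ∈ Fin (K + L) ] elem′ (splitAt K u) ≈ x
    onto x (inj₁ p) with elem-onto eP x p
    ... | i , eq = i ↑ˡ L , subst (λ u → elem′ u ≈ x) (sym (splitAt-↑ˡ K i L)) eq
    onto x (inj₂ q) with elem-onto eQ x q
    ... | j , eq = K ↑ʳ j , subst (λ u → elem′ u ≈ x) (sym (splitAt-↑ʳ K L j)) eq

Counts-byValue : {Q : Fin n → Set} {P : Endo n → Set} (eQ : Enumeration _≡_ Q s) (x : Fin n) →
                 (∀ f → P f → Q (f x)) →
                 (∀ i → Counts n (λ f → P f × f x ≡ elem eQ i) K) →
                 Counts n P (s * K)
Counts-byValue {n = n} {s = s} {K = K} {P = P} eQ x value∈Q count = record
  { elem = pick ∘ split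
  ; elem-∈ = λ ι → proj₁ (elem-∈ (count (proj₁ (split ι))) (proj₂ (split ι)))
  ; elem-injective = λ ι ι′ eq →
      trans (sym (combine-remQuot {s} K ι))
            (trans (cong (uncurry combine) (pick-injective (split ι) (split ι′) eq)) (combine-remQuot {s} K ι′))
  ; elem-onto = onto
  }
  where
  split : Fin (s * K) → Fin s × Fin K
  split = remQuot K

  pick : Fin s × Fin K → Endo n
  pick (i , j) = elem (count i) j

  pick-injective : ∀ u v → pick u ≗ pick v → u ≡ v
  pick-injective (i , j) (i′ , j′) eq
    with elem-injective eQ i i′
           (trans (sym (proj₂ (elem-∈ (count i) j))) (trans (eq x) (proj₂ (elem-∈ (count i′) j′))))
  ... | refl = cong (i ,_) (elem-injective (count i) j j′ eq)

  onto : ∀ f → P f → Σ[ ι ∈ Fin (s * K) ] pick (split ι) ≗ f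
  onto f Pf with elem-onto eQ (f x) (value∈Q f Pf)
  ... | i , eq with elem-onto (count i) f (Pf , sym eq)
  ... | j , eq′ = combine i j , subst (λ u → pick u ≗ f) (sym (remQuot-combine i j)) eq′

Avoids : List (Fin n) → Fin n → Set
Avoids ps x = All (x ≢_) ps

¬Avoids⇒∈ : ∀ {ps} {x : Fin n} → ¬ Avoids ps x → x ∈ ps
¬Avoids⇒∈ {ps = ps} {x} ¬avoids =
  Any.map (decidable-stable (_ ≟ _)) (¬All⇒Any¬ (λ y → ¬? (x ≟ y)) ps ¬avoids)

Enumeration-remove : ∀ {ps : List (Fin n)} (e : Enumeration _≡_ (Avoids ps) (suc s)) (i : Fin (suc s)) →
                     Enumeration _≡_ (Avoids (elem e i ∷ ps)) s
Enumeration-remove e i = record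
  { elem = elem e ∘ punchIn i
  ; elem-∈ = λ j → (punchInᵢ≢i i j ∘ elem-injective e _ _) ∷ elem-∈ e (punchIn i j)
  ; elem-injective = λ j k eq → punchIn-injective i j k (elem-injective e _ _ eq)
  ; elem-onto = onto
  }
  where
  onto : ∀ x → Avoids (elem e i ∷ _) x → Σ[ j ∈ Fin _ ] elem e (punchIn i j) ≡ x
  onto x (x≢eᵢ ∷ avoids) with elem-onto e x avoids
  ... | k , refl = punchOut i≢k , cong (elem e) (punchIn-punchOut i≢k)
    where
    i≢k : i ≢ k
    i≢k refl = x≢eᵢ refl

Periodic : ℕ → (A → A) → Set
Periodic k f = ∀ x → iterate f x k ≡ x

periodic-injective : ∀ {k} {f : A → A} → Periodic (suc k) f → ∀ {x y} → f x ≡ f y → x ≡ y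
periodic-injective {k = k} {f} per {x} {y} eq =
  trans (sym (per x)) (trans (cong (λ z → iterate f z k) eq) (per y))

iterate-preserves : ∀ {S : A → Set} {g : A → A} → (∀ y → S y → S (g y)) →
                    ∀ {x} → S x → ∀ k → S (iterate g x k)
iterate-preserves closed Sx zero    = Sx
iterate-preserves closed Sx (suc k) = iterate-preserves closed (closed _ Sx) k

iterate-agree : ∀ {S : A → Set} {f g : A → A} → (∀ y → S y → S (g y)) → (∀ y → S y → f y ≡ g y) →
                ∀ {x} → S x → ∀ k → iterate f x k ≡ iterate g x k
iterate-agree closed agree Sx zero = refl
iterate-agree closed agree {x} Sx (suc k) rewrite agree x Sx = iterate-agree closed agree (closed _ Sx) k

module Extension {Q : Fin n → Set} (eQ : Enumeration _≡_ Q s) (k : ℕ) (c : Endo n)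
  (c-closed : ∀ x → ¬ Q x → ¬ Q (c x))
  (c-periodic : ∀ x → ¬ Q x → iterate c x (suc k) ≡ x) where

  AgreesOff : Endo n → Set
  AgreesOff f = ∀ x → ¬ Q x → f x ≡ c x

  private
    Image : Fin n → Set
    Image x = Σ[ i ∈ Fin s ] elem eQ i ≡ x

    image? : ∀ x → Dec (Image x)
    image? x = any? (λ i → elem eQ i ≟ x)

    ¬Image⇒¬Q : ∀ {x} → ¬ Image x → ¬ Q x
    ¬Image⇒¬Q {x} ¬image q = ¬image (elem-onto eQ x q)

    image⊎off : ∀ x → Image x ⊎ ¬ Q x
    image⊎off x with image? x
    ... | yes image = inj₁ image
    ... | no ¬image = inj₂ (¬Image⇒¬Q ¬image)

  extend : Endo s → Endo n
  extend g x with image? x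
  ... | yes (i , _) = elem eQ (g i)
  ... | no _        = c x

  extend-elem : ∀ g i → extend g (elem eQ i) ≡ elem eQ (g i)
  extend-elem g i with image? (elem eQ i)
  ... | yes (i′ , eq) = cong (elem eQ ∘ g) (elem-injective eQ i′ i eq)
  ... | no ¬image     = ⊥-elim (¬image (i , refl))

  extend-off : ∀ g → AgreesOff (extend g)
  extend-off g x ¬q with image? x
  ... | yes (i , refl) = ⊥-elim (¬q (elem-∈ eQ i))
  ... | no _           = refl

  iterate-extend-elem : ∀ g i j → iterate (extend g) (elem eQ i) j ≡ elem eQ (iterate g i j)
  iterate-extend-elem g i zero = refl
  iterate-extend-elem g i (suc j) rewrite extend-elem g i = iterate-extend-elem g (g i) j

  extend-periodic : ∀ g → Periodic (suc k) g → Periodic (suc k) (extend g)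
  extend-periodic g per x with image⊎off x
  ... | inj₁ (i , refl) = trans (iterate-extend-elem g i (suc k)) (cong (elem eQ) (per i))
  ... | inj₂ ¬q         = trans (iterate-agree c-closed (extend-off g) ¬q (suc k)) (c-periodic x ¬q)

  extend-cong : ∀ g g′ → g ≗ g′ → extend g ≗ extend g′
  extend-cong g g′ eq x with image⊎off x
  ... | inj₁ (i , refl) = trans (extend-elem g i) (trans (cong (elem eQ) (eq i)) (sym (extend-elem g′ i)))
  ... | inj₂ ¬q         = trans (extend-off g x ¬q) (sym (extend-off g′ x ¬q))

  extend-injective : ∀ g g′ → extend g ≗ extend g′ → g ≗ g′
  extend-injective g g′ eq i =
    elem-injective eQ _ _ (trans (sym (extend-elem g i)) (trans (eq (elem eQ i)) (extend-elem g′ i)))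

  module Restriction (f : Endo n) (per : Periodic (suc k) f) (agrees : AgreesOff f) where

    -- Were f (elem i) off Q, its orbit would stay off Q, yet it returns to elem i.
    image : ∀ i → Image (f (elem eQ i))
    image i = decidable-stable (image? _) λ ¬image →
      iterate-preserves c-closed (¬Image⇒¬Q ¬image) k
        (subst Q (trans (sym (per (elem eQ i))) (iterate-agree c-closed agrees (¬Image⇒¬Q ¬image) k))
               (elem-∈ eQ i))

    restrict : Endo s
    restrict i = proj₁ (image i)

    iterate-restrict : ∀ i j → elem eQ (iterate restrict i j) ≡ iterate f (elem eQ i) j
    iterate-restrict i zero = refl
    iterate-restrict i (suc j) =
      trans (iterate-restrict (restrict i) j) (cong (λ y → iterate f y j) (proj₂ (image i)))

    restrict-periodic : Periodic (suc k) restrict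
    restrict-periodic i = elem-injective eQ _ _ (trans (iterate-restrict i (suc k)) (per (elem eQ i)))

    extend-restrict : extend restrict ≗ f
    extend-restrict x with image⊎off x
    ... | inj₁ (i , refl) = trans (extend-elem restrict i) (proj₂ (image i))
    ... | inj₂ ¬q         = trans (extend-off restrict x ¬q) (sym (agrees x ¬q))

  Counts-extend : Counts s (Periodic (suc k)) K → Counts n (λ f → Periodic (suc k) f × AgreesOff f) K
  Counts-extend e = record
    { elem = extend ∘ elem e
    ; elem-∈ = λ i → extend-periodic _ (elem-∈ e i) , extend-off _
    ; elem-injective = λ i j eq → elem-injective e i j (extend-injective _ _ eq)
    ; elem-onto = λ f (per , agrees) → let open Restriction f per agrees in
        let (i , eq) = elem-onto e restrict restrict-periodic in
        i , λ x → trans (extend-cong _ _ eq x) (extend-restrict x)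
    }

iterate-path₅ : ∀ (f : A → A) {x₀ x₁ x₂ x₃ x₄ x₅} →
                f x₀ ≡ x₁ → f x₁ ≡ x₂ → f x₂ ≡ x₃ → f x₃ ≡ x₄ → f x₄ ≡ x₅ → iterate f x₀ 5 ≡ x₅
iterate-path₅ f refl refl refl refl refl = refl

∈⇒¬Avoids : ∀ {ps} {x : Fin n} → x ∈ ps → ¬ Avoids ps x
∈⇒¬Avoids x∈ps avoids = All¬⇒¬Any avoids x∈ps

update : Fin n → Fin n → Endo n → Endo n
update u v f x with x ≟ u
... | yes _ = v
... | no _  = f x

update-≡ : ∀ (u : Fin n) {v f} → update u v f u ≡ v
update-≡ u with u ≟ u
... | yes _  = refl
... | no u≢u = ⊥-elim (u≢u refl)

update-≢ : ∀ {u v x : Fin n} {f} → x ≢ u → update u v f x ≡ f x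
update-≢ {u = u} {x = x} x≢u with x ≟ u
... | yes x≡u = ⊥-elim (x≢u x≡u)
... | no _    = refl

Walk₂ : Fin n → Fin n → Endo n → Set
Walk₂ p a f = Periodic 5 f × f p ≡ a

Walk₃ : Fin n → Fin n → Fin n → Endo n → Set
Walk₃ p a b f = Walk₂ p a f × f a ≡ b

Walk₄ : Fin n → Fin n → Fin n → Fin n → Endo n → Set
Walk₄ p a b c f = Walk₃ p a b f × f b ≡ c

Walk₅ : Fin n → Fin n → Fin n → Fin n → Fin n → Endo n → Set
Walk₅ p a b c d f = Walk₄ p a b c f × f c ≡ d

-- The next point of a walk is new: f is injective, and a return to p after fewer than five steps
-- would make f⁵ p differ from p.
module _ {f : Endo n} {p a : Fin n} where

  private
    injective : Periodic 5 f → ∀ {x y} → f x ≡ f y → x ≡ y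
    injective = periodic-injective {k = 4}

  walk₂-fresh : Unique (a ∷ p ∷ []) → Walk₂ p a f → Avoids (a ∷ p ∷ []) (f a)
  walk₂-fresh ((a≢p ∷ []) ∷ [] ∷ []) (per , fp) =
      (λ fa≡a → a≢p (injective per (trans fa≡a (sym fp))))
    ∷ (λ fa≡p → a≢p (trans (sym (iterate-path₅ f fp fa≡p fp fa≡p fp)) (per p)))
    ∷ []

  walk₃-fresh : ∀ {b} → Unique (b ∷ a ∷ p ∷ []) → Walk₃ p a b f → Avoids (b ∷ a ∷ p ∷ []) (f b)
  walk₃-fresh ((b≢a ∷ b≢p ∷ []) ∷ _) ((per , fp) , fa) =
      (λ fb≡b → b≢a (injective per (trans fb≡b (sym fa))))
    ∷ (λ fb≡a → b≢p (injective per (trans fb≡a (sym fp))))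
    ∷ (λ fb≡p → b≢p (trans (sym (iterate-path₅ f fp fa fb≡p fp fa)) (per p)))
    ∷ []

  walk₄-fresh : ∀ {b c} → Unique (c ∷ b ∷ a ∷ p ∷ []) → Walk₄ p a b c f →
                Avoids (c ∷ b ∷ a ∷ p ∷ []) (f c)
  walk₄-fresh ((c≢b ∷ c≢a ∷ c≢p ∷ []) ∷ (_ ∷ _ ∷ []) ∷ (a≢p ∷ []) ∷ _) (((per , fp) , fa) , fb) =
      (λ fc≡c → c≢b (injective per (trans fc≡c (sym fb))))
    ∷ (λ fc≡b → c≢a (injective per (trans fc≡b (sym fa))))
    ∷ (λ fc≡a → c≢p (injective per (trans fc≡a (sym fp))))
    ∷ (λ fc≡p → a≢p (trans (sym (iterate-path₅ f fp fa fb fc≡p fp)) (per p)))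
    ∷ []

-- A walk p ↦ a ↦ b ↦ c ↦ d of a periodic f closes up (f d ≡ p), so f agrees with σ on {p, a, b, c, d}.
module _ {p a b c d : Fin n} (σ : Endo n)
  (σp : σ p ≡ a) (σa : σ a ≡ b) (σb : σ b ≡ c) (σc : σ c ≡ d) (σd : σ d ≡ p) where

  private
    σ-∈ : ∀ {x} → x ∈ d ∷ c ∷ b ∷ a ∷ p ∷ [] → σ x ∈ d ∷ c ∷ b ∷ a ∷ p ∷ []
    σ-∈ (here refl)                                 = there (there (there (there (here σd))))
    σ-∈ (there (here refl))                         = here σc
    σ-∈ (there (there (here refl)))                 = there (here σb)
    σ-∈ (there (there (there (here refl))))         = there (there (here σa))
    σ-∈ (there (there (there (there (here refl))))) = there (there (there (here σp)))

    σ-periodic : ∀ {x} → x ∈ d ∷ c ∷ b ∷ a ∷ p ∷ [] → iterate σ x 5 ≡ x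
    σ-periodic (here refl)                                 = iterate-path₅ σ σd σp σa σb σc
    σ-periodic (there (here refl))                         = iterate-path₅ σ σc σd σp σa σb
    σ-periodic (there (there (here refl)))                 = iterate-path₅ σ σb σc σd σp σa
    σ-periodic (there (there (there (here refl))))         = iterate-path₅ σ σa σb σc σd σp
    σ-periodic (there (there (there (there (here refl))))) = iterate-path₅ σ σp σa σb σc σd

  Counts-Walk₅-via : ∀ {t K} → Enumeration _≡_ (Avoids (d ∷ c ∷ b ∷ a ∷ p ∷ [])) t →
                     Counts t (Periodic 5) K →
                     Counts n (Walk₅ p a b c d) K
  Counts-Walk₅-via eQ counts = Enumeration-cong to from (Counts-extend counts)
    where
    open Extension eQ 4 σ (λ _ ¬avoids → ∈⇒¬Avoids (σ-∈ (¬Avoids⇒∈ ¬avoids)))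
                            (λ _ ¬avoids → σ-periodic (¬Avoids⇒∈ ¬avoids))
      using (AgreesOff; Counts-extend)

    to : ∀ f → Periodic 5 f × AgreesOff f → Walk₅ p a b c d f
    to f (per , agrees) =
      (((per , trans (on p∈) σp) , trans (on a∈) σa) , trans (on b∈) σb) , trans (on c∈) σc
      where
      on : ∀ {x} → x ∈ d ∷ c ∷ b ∷ a ∷ p ∷ [] → f x ≡ σ x
      on x∈ps = agrees _ (∈⇒¬Avoids x∈ps)
      c∈ = there (here refl)
      b∈ = there (there (here refl))
      a∈ = there (there (there (here refl)))
      p∈ = there (there (there (there (here refl))))

    from : ∀ f → Walk₅ p a b c d f → Periodic 5 f × AgreesOff f
    from f ((((per , fp) , fa) , fb) , fc) = per , λ _ ¬avoids → agree (¬Avoids⇒∈ ¬avoids)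
      where
      agree : ∀ {x} → x ∈ d ∷ c ∷ b ∷ a ∷ p ∷ [] → f x ≡ σ x
      agree (here refl) = trans (trans (sym (iterate-path₅ f fp fa fb fc refl)) (per p)) (sym σd)
      agree (there (here refl))                         = trans fc (sym σc)
      agree (there (there (here refl)))                 = trans fb (sym σb)
      agree (there (there (there (here refl))))         = trans fa (sym σa)
      agree (there (there (there (there (here refl))))) = trans fp (sym σp)

Counts-Walk₅ : ∀ {p a b c d : Fin n} {t K} → Unique (d ∷ c ∷ b ∷ a ∷ p ∷ []) →
               Enumeration _≡_ (Avoids (d ∷ c ∷ b ∷ a ∷ p ∷ [])) t → Counts t (Periodic 5) K →
               Counts n (Walk₅ p a b c d) K
Counts-Walk₅ {p = p} {a} {b} {c} {d}
  ((d≢c ∷ d≢b ∷ d≢a ∷ d≢p ∷ []) ∷ (c≢b ∷ c≢a ∷ c≢p ∷ []) ∷ (b≢a ∷ b≢p ∷ []) ∷ (a≢p ∷ []) ∷ [] ∷ []) =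
  Counts-Walk₅-via σ (update-≡ p)
    (trans (update-≢ a≢p) (update-≡ a))
    (trans (update-≢ b≢p) (trans (update-≢ b≢a) (update-≡ b)))
    (trans (update-≢ c≢p) (trans (update-≢ c≢a) (trans (update-≢ c≢b) (update-≡ c))))
    (trans (update-≢ d≢p) (trans (update-≢ d≢a) (trans (update-≢ d≢b) (trans (update-≢ d≢c) (update-≡ d)))))
  where
  σ = update p a (update a b (update b c (update c d (update d p (λ x → x)))))

Counts-Walk₄ : ∀ {p a b c : Fin n} → Unique (c ∷ b ∷ a ∷ p ∷ []) →
               Enumeration _≡_ (Avoids (c ∷ b ∷ a ∷ p ∷ [])) s → Counts (s ∸ 1) (Periodic 5) K →
               Counts n (Walk₄ p a b c) (s * K)
Counts-Walk₄ {s = zero}  {K} {c = c} u eQ _ = Counts-byValue {K = K} eQ c (λ f → walk₄-fresh {f = f} u) (λ ())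
Counts-Walk₄ {s = suc _} {c = c} u eQ counts = Counts-byValue eQ c (λ f → walk₄-fresh {f = f} u) λ i →
  Counts-Walk₅ (elem-∈ eQ i ∷ u) (Enumeration-remove eQ i) counts

Counts-Walk₃ : ∀ {p a b : Fin n} → Unique (b ∷ a ∷ p ∷ []) →
               Enumeration _≡_ (Avoids (b ∷ a ∷ p ∷ [])) s → Counts (s ∸ 1 ∸ 1) (Periodic 5) K →
               Counts n (Walk₃ p a b) (s * ((s ∸ 1) * K))
Counts-Walk₃ {s = zero}  {K} {b = b} u eQ _ = Counts-byValue {K = K} eQ b (λ f → walk₃-fresh {f = f} u) (λ ())
Counts-Walk₃ {s = suc _} {b = b} u eQ counts = Counts-byValue eQ b (λ f → walk₃-fresh {f = f} u) λ i →
  Counts-Walk₄ (elem-∈ eQ i ∷ u) (Enumeration-remove eQ i) counts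

Counts-Walk₂ : ∀ {p a : Fin n} → Unique (a ∷ p ∷ []) →
               Enumeration _≡_ (Avoids (a ∷ p ∷ [])) s → Counts (s ∸ 1 ∸ 1 ∸ 1) (Periodic 5) K →
               Counts n (Walk₂ p a) (s * ((s ∸ 1) * ((s ∸ 1 ∸ 1) * K)))
Counts-Walk₂ {s = zero}  {K} {a = a} u eQ _ = Counts-byValue {K = K} eQ a (λ f → walk₂-fresh {f = f} u) (λ ())
Counts-Walk₂ {s = suc _} {a = a} u eQ counts = Counts-byValue eQ a (λ f → walk₂-fresh {f = f} u) λ i →
  Counts-Walk₃ (elem-∈ eQ i ∷ u) (Enumeration-remove eQ i) counts

Counts-moving : ∀ {p : Fin n} → Enumeration _≡_ (Avoids (p ∷ [])) s →
                Counts (s ∸ 1 ∸ 1 ∸ 1 ∸ 1) (Periodic 5) K →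
                Counts n (λ f → Periodic 5 f × f p ≢ p)
                       (s * ((s ∸ 1) * ((s ∸ 1 ∸ 1) * ((s ∸ 1 ∸ 1 ∸ 1) * K))))
Counts-moving {s = zero}  {K} {p = p} eQ _ = Counts-byValue {K = K} eQ p (λ _ (_ , fp≢p) → fp≢p ∷ []) (λ ())
Counts-moving {s = suc _} {p = p} eQ counts = Counts-byValue eQ p (λ _ (_ , fp≢p) → fp≢p ∷ []) λ i →
  Enumeration-cong (λ _ (per , fp) → (per , λ fp≡p → head (elem-∈ eQ i) (trans (sym fp) fp≡p)) , fp)
                   (λ _ ((per , _) , fp) → per , fp)
                   (Counts-Walk₂ (elem-∈ eQ i ∷ [] ∷ []) (Enumeration-remove eQ i) counts)

nonzero : Enumeration _≡_ (Avoids (zero ∷ [])) n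
nonzero = record
  { elem = suc
  ; elem-∈ = λ _ → (λ ()) ∷ []
  ; elem-injective = λ _ _ → suc-injective
  ; elem-onto = λ where
      zero    (0≢0 ∷ []) → ⊥-elim (0≢0 refl)
      (suc i) _          → i , refl
  }

Counts-fixing : Counts n (Periodic 5) K → Counts (suc n) (λ f → Periodic 5 f × f zero ≡ zero) K
Counts-fixing counts = Enumeration-cong to from (Counts-extend counts)
  where
  open Extension nonzero 4 (λ x → x) (λ _ ¬avoids → ¬avoids) (λ _ _ → refl) using (AgreesOff; Counts-extend)

  to : ∀ f → Periodic 5 f × AgreesOff f → Periodic 5 f × f zero ≡ zero
  to f (per , agrees) = per , agrees zero λ { (0≢0 ∷ []) → 0≢0 refl }

  from : ∀ f → Periodic 5 f × f zero ≡ zero → Periodic 5 f × AgreesOff f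
  from f (per , f0≡0) = per , λ where
    zero    _       → f0≡0
    (suc i) ¬avoids → ⊥-elim (¬avoids ((λ ()) ∷ []))

Counts-suc : ∀ {m} → Counts m (Periodic 5) K → Counts (m ∸ 1 ∸ 1 ∸ 1 ∸ 1) (Periodic 5) L →
             Counts (suc m) (Periodic 5) (K + m * ((m ∸ 1) * ((m ∸ 1 ∸ 1) * ((m ∸ 1 ∸ 1 ∸ 1) * L))))
Counts-suc counts counts′ =
  Enumeration-cong (λ _ → [ proj₁ , proj₁ ]′) from
    (Enumeration-⊎ (λ eq x → sym (eq x)) disjoint (Counts-fixing counts) (Counts-moving nonzero counts′))
  where
  disjoint : ∀ f g → Periodic 5 f × f zero ≡ zero → Periodic 5 g × g zero ≢ zero → ¬ f ≗ g
  disjoint f g (_ , f0≡0) (_ , g0≢0) f≗g = g0≢0 (trans (sym (f≗g zero)) f0≡0)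

  from : ∀ f → Periodic 5 f → (Periodic 5 f × f zero ≡ zero) ⊎ (Periodic 5 f × f zero ≢ zero)
  from f per with f zero ≟ zero
  ... | yes f0≡0 = inj₁ (per , f0≡0)
  ... | no f0≢0  = inj₂ (per , f0≢0)

-- The number of x ∈ S_m that are products of j disjoint 5-cycles, defined by the recursion that
-- splitting off the cycle through one point gives.
cycles₅ : ℕ → ℕ → ℕ
cycles₅ _ zero = 1
cycles₅ (suc m@(suc (suc (suc (suc k))))) (suc j) =
  cycles₅ m (suc j) + (4 + k) * ((3 + k) * ((2 + k) * ((1 + k) * cycles₅ k j)))
cycles₅ _ (suc j) = 0

cycles₅-vanish : ∀ m j → m < 5 * j → cycles₅ m j ≡ 0
cycles₅-vanish 0 (suc j) _ = refl
cycles₅-vanish 1 (suc j) _ = refl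
cycles₅-vanish 2 (suc j) _ = refl
cycles₅-vanish 3 (suc j) _ = refl
cycles₅-vanish 4 (suc j) _ = refl
cycles₅-vanish (suc m@(suc (suc (suc (suc k))))) (suc j) lt
  rewrite cycles₅-vanish m (suc j) (<-trans (n<1+n m) lt)
        | cycles₅-vanish k j (+-cancelˡ-< 5 k (5 * j) (subst (5 + k <_) (*-suc 5 j) lt)) = vanishing k
  where
  vanishing : ∀ k → 0 + (4 + k) * ((3 + k) * ((2 + k) * ((1 + k) * 0))) ≡ 0
  vanishing = solve-∀

cycles₅-closed : ∀ j r → cycles₅ (5 * j + r) j * ((r ! * j !) * 5 ^ j) ≡ (5 * j + r) !
cycles₅-closed zero r = unit (r !)
  where
  unit : ∀ x → 1 * ((x * 1) * 1) ≡ x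
  unit = solve-∀
cycles₅-closed (suc j) r =
  subst (λ m → cycles₅ m (suc j) * ((r ! * suc j !) * 5 ^ suc j) ≡ m !) (sym (five-suc j r)) (step r)
  where
  five-suc : ∀ j r → 5 * suc j + r ≡ 5 + (5 * j + r)
  five-suc = solve-∀

  open ≡-Reasoning

  step : ∀ r → let k = 5 * j + r in
         cycles₅ (5 + k) (suc j) * ((r ! * suc j !) * 5 ^ suc j) ≡ (5 + k) !
  step zero = begin
    (cycles₅ (4 + k) (suc j) + P) * D
      ≡⟨ cong (λ c → (c + P) * D) (cycles₅-vanish (4 + k) (suc j) 4+k<5[1+j]) ⟩
    (0 + P) * D
      ≡⟨ regroup j c (j !) (5 ^ j) ⟩
    (5 + k) * ((4 + k) * ((3 + k) * ((2 + k) * ((1 + k) * (c * ((0 ! * j !) * 5 ^ j))))))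
      ≡⟨ cong (λ x → (5 + k) * ((4 + k) * ((3 + k) * ((2 + k) * ((1 + k) * x))))) (cycles₅-closed j zero) ⟩
    (5 + k) ! ∎
    where
    k = 5 * j + 0
    c = cycles₅ k j
    P = (4 + k) * ((3 + k) * ((2 + k) * ((1 + k) * c)))
    D = (0 ! * suc j !) * 5 ^ suc j
    regroup : ∀ j c F Q → let k = 5 * j + 0 in
      (0 + (4 + k) * ((3 + k) * ((2 + k) * ((1 + k) * c)))) * ((1 * (suc j * F)) * (5 * Q))
      ≡ (5 + k) * ((4 + k) * ((3 + k) * ((2 + k) * ((1 + k) * (c * ((1 * F) * Q))))))
    regroup = solve-∀
    4+k<5[1+j] : 4 + k < 5 * suc j
    4+k<5[1+j] = subst (4 + k <_) (sym (*-suc 5 j)) (≤-reflexive (cong (5 +_) (+-identityʳ (5 * j))))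
  step (suc r) = begin
    (c′ + P) * ((suc r ! * suc j !) * 5 ^ suc j)
      ≡⟨ regroup j r c′ c (r !) (j !) (5 ^ j) ⟩
    (c′ * E) * suc r + (4 + k) * ((3 + k) * ((2 + k) * ((1 + k) * (c * ((suc r ! * j !) * 5 ^ j))))) * (5 * suc j)
      ≡⟨ cong₂ (λ x y → x * suc r + (4 + k) * ((3 + k) * ((2 + k) * ((1 + k) * y)))  * (5 * suc j))
               (subst (λ m → cycles₅ m (suc j) * E ≡ m !) (shift j r) (cycles₅-closed (suc j) r))
               (cycles₅-closed j (suc r)) ⟩
    (4 + k) ! * suc r + (4 + k) ! * (5 * suc j)
      ≡⟨ collect j r ((4 + k) !) ⟩
    (5 + k) ! ∎
    where
    k = 5 * j + suc r
    c′ = cycles₅ (4 + k) (suc j)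
    c = cycles₅ k j
    P = (4 + k) * ((3 + k) * ((2 + k) * ((1 + k) * c)))
    E = (r ! * suc j !) * 5 ^ suc j
    shift : ∀ j r → 5 * suc j + r ≡ 4 + (5 * j + suc r)
    shift = solve-∀
    regroup : ∀ j r A c R J Q → let k = 5 * j + suc r in
      (A + (4 + k) * ((3 + k) * ((2 + k) * ((1 + k) * c)))) * (((suc r * R) * (suc j * J)) * (5 * Q))
      ≡ (A * ((R * (suc j * J)) * (5 * Q))) * suc r
        + (4 + k) * ((3 + k) * ((2 + k) * ((1 + k) * (c * (((suc r * R) * J) * Q))))) * (5 * suc j)
    regroup = solve-∀
    collect : ∀ j r F → F * suc r + F * (5 * suc j) ≡ (5 + (5 * j + suc r)) * F
    collect = solve-∀

sumBelow : ℕ → (ℕ → ℕ) → ℕ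
sumBelow zero    f = 0
sumBelow (suc L) f = f 0 + sumBelow L (λ i → f (suc i))

sum-applyUpTo : ∀ L (f g : ℕ → ℕ) → sum (map f (applyUpTo g L)) ≡ sumBelow L (λ i → f (g i))
sum-applyUpTo zero    f g = refl
sum-applyUpTo (suc L) f g = cong (f (g 0) +_) (sum-applyUpTo L f (λ i → g (suc i)))

sumTo≡sumBelow : ∀ n f → sumTo n f ≡ sumBelow (suc n) f
sumTo≡sumBelow n f = sum-applyUpTo (suc n) f (λ i → i)

sumBelow-cong : ∀ L {f g} → (∀ i → i < L → f i ≡ g i) → sumBelow L f ≡ sumBelow L g
sumBelow-cong zero    eq = refl
sumBelow-cong (suc L) eq = cong₂ _+_ (eq 0 z<s) (sumBelow-cong L (λ i i<L → eq (suc i) (s<s i<L)))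

sumBelow-+ : ∀ L f g → sumBelow L (λ i → f i + g i) ≡ sumBelow L f + sumBelow L g
sumBelow-+ zero    f g = refl
sumBelow-+ (suc L) f g =
  trans (cong (f 0 + g 0 +_) (sumBelow-+ L _ _)) (interchange (f 0) (g 0) (sumBelow L _) (sumBelow L _))
  where
  interchange : ∀ a b c d → a + b + (c + d) ≡ a + c + (b + d)
  interchange = solve-∀

sumBelow-additive : ∀ L (h : ℕ → ℕ) f → h 0 ≡ 0 → (∀ x y → h (x + y) ≡ h x + h y) →
                sumBelow L (λ i → h (f i)) ≡ h (sumBelow L f)
sumBelow-additive zero    h f h0 h+ = sym h0
sumBelow-additive (suc L) h f h0 h+ =
  trans (cong (h (f 0) +_) (sumBelow-additive L h (λ i → f (suc i)) h0 h+)) (sym (h+ (f 0) _))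

sumBelow-zero : ∀ L f → (∀ i → f i ≡ 0) → sumBelow L f ≡ 0
sumBelow-zero zero    f eq = refl
sumBelow-zero (suc L) f eq = cong₂ _+_ (eq 0) (sumBelow-zero L _ (λ i → eq (suc i)))

sumBelow-cutoff : ∀ {L M} f → L ≤ M → (∀ i → L ≤ i → f i ≡ 0) → sumBelow M f ≡ sumBelow L f
sumBelow-cutoff {zero} {M}    f _         vanish = sumBelow-zero M f (λ i → vanish i z≤n)
sumBelow-cutoff {suc L} {suc M} f (s≤s L≤M) vanish =
  cong (f 0 +_) (sumBelow-cutoff _ L≤M (λ i L≤i → vanish (suc i) (s≤s L≤i)))

sumBelow-snoc : ∀ L f → sumBelow (suc L) f ≡ sumBelow L f + f L
sumBelow-snoc zero    f = +-comm (f 0) 0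
sumBelow-snoc (suc L) f = trans (cong (f 0 +_) (sumBelow-snoc L _)) (sym (+-assoc (f 0) _ _))

sumBelow-reverse : ∀ L f → sumBelow L f ≡ sumBelow L (λ i → f (L ∸ suc i))
sumBelow-reverse zero    f = refl
sumBelow-reverse (suc L) f = begin
  f 0 + sumBelow L (λ i → f (suc i))
    ≡⟨ cong (f 0 +_) (sumBelow-reverse L _) ⟩
  f 0 + sumBelow L (λ i → f (suc (L ∸ suc i)))
    ≡⟨ +-comm (f 0) _ ⟩
  sumBelow L (λ i → f (suc (L ∸ suc i))) + f 0
    ≡⟨ cong₂ _+_ (sumBelow-cong L (λ i i<L → cong f (sym (+-∸-assoc 1 i<L)))) (cong f (sym (n∸n≡0 L))) ⟩
  sumBelow L (λ i → f (suc L ∸ suc i)) + f (suc L ∸ suc L)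
    ≡⟨ sumBelow-snoc L _ ⟨
  sumBelow (suc L) (λ i → f (suc L ∸ suc i)) ∎
  where open ≡-Reasoning

sumBelow-pairs : ∀ q f → sumBelow (2 * q) f ≡ sumBelow q (λ j → f (2 * j) + f (suc (2 * j)))
sumBelow-pairs zero    f = refl
sumBelow-pairs (suc q) f = begin
  sumBelow (2 * suc q) f
    ≡⟨ cong (λ L → sumBelow L f) (*-suc 2 q) ⟩
  f 0 + (f 1 + sumBelow (2 * q) (λ i → f (2 + i)))
    ≡⟨ +-assoc (f 0) (f 1) _ ⟨
  f 0 + f 1 + sumBelow (2 * q) (λ i → f (2 + i))
    ≡⟨ cong (f 0 + f 1 +_) (sumBelow-pairs q _) ⟩
  f 0 + f 1 + sumBelow q (λ j → f (2 + 2 * j) + f (3 + 2 * j))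
    ≡⟨ cong (f 0 + f 1 +_) (sumBelow-cong q λ j _ →
         cong₂ (λ a b → f a + f (suc b)) (sym (*-suc 2 j)) (sym (*-suc 2 j))) ⟩
  f 0 + f 1 + sumBelow q (λ j → f (2 * suc j) + f (suc (2 * suc j))) ∎
  where open ≡-Reasoning

sumTo-by-parity : ∀ n (f g h : ℕ → ℕ) → f 0 ≡ 0 →
                  (∀ j → f (n ∸ 2 * j) ≡ g j) → (∀ j → f (n ∸ suc (2 * j)) ≡ h j) →
                  sumTo n f ≡ sumBelow (suc n) (λ j → g j + h j)
sumTo-by-parity n f g h f0≡0 even odd = begin
  sumTo n f
    ≡⟨ sumTo≡sumBelow n f ⟩
  sumBelow (suc n) f
    ≡⟨ sumBelow-reverse (suc n) f ⟩
  sumBelow (suc n) (λ i → f (n ∸ i))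
    ≡⟨ sumBelow-cutoff (λ i → f (n ∸ i)) (m≤n*m (suc n) 2)
                       (λ i n<i → trans (cong f (m≤n⇒m∸n≡0 (<⇒≤ n<i))) f0≡0) ⟨
  sumBelow (2 * suc n) (λ i → f (n ∸ i))
    ≡⟨ sumBelow-pairs (suc n) (λ i → f (n ∸ i)) ⟩
  sumBelow (suc n) (λ j → f (n ∸ 2 * j) + f (n ∸ suc (2 * j)))
    ≡⟨ sumBelow-cong (suc n) (λ j _ → cong₂ _+_ (even j) (odd j)) ⟩
  sumBelow (suc n) (λ j → g j + h j) ∎
  where open ≡-Reasoning

∸-split : ∀ n i (f : ℕ → ℕ) {y} → (∀ k → i + k ≡ n → f k ≡ y) → (n < i → f 0 ≡ y) → f (n ∸ i) ≡ y
∸-split n i f within beyond with ≤-<-connex i n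
... | inj₂ n<i = trans (cong f (m≤n⇒m∸n≡0 (<⇒≤ n<i))) (beyond n<i)
... | inj₁ i≤n with m≤n⇒∃[o]m+o≡n i≤n
...   | k , i+k≡n = trans (cong f (trans (cong (_∸ i) (sym i+k≡n)) (m+n∸m≡n i k))) (within k i+k≡n)

roots₅ : ℕ → ℕ
roots₅ m = sumBelow (suc m) (cycles₅ m)

roots₅-sum : ∀ {m} L → m < 5 * L → roots₅ m ≡ sumBelow L (cycles₅ m)
roots₅-sum {m} L m<5L with ≤-total (suc m) L
... | inj₁ m<L = sym (sumBelow-cutoff _ m<L (λ i m<i → cycles₅-vanish m i (<-≤-trans m<i (m≤n*m i 5))))
... | inj₂ L≤1+m = sumBelow-cutoff _ L≤1+m (λ i L≤i → cycles₅-vanish m i (<-≤-trans m<5L (*-monoʳ-≤ 5 L≤i)))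

roots₅-suc : ∀ m → roots₅ (suc m) ≡
             roots₅ m + m * ((m ∸ 1) * ((m ∸ 1 ∸ 1) * ((m ∸ 1 ∸ 1 ∸ 1) * roots₅ (m ∸ 1 ∸ 1 ∸ 1 ∸ 1))))
roots₅-suc 0 = refl
roots₅-suc 1 = refl
roots₅-suc 2 = refl
roots₅-suc 3 = refl
roots₅-suc (suc (suc (suc (suc k)))) = begin
  1 + sumBelow (5 + k) (λ j → cycles₅ (4 + k) (suc j) + P (cycles₅ k j))
    ≡⟨ cong suc (sumBelow-+ (5 + k) (λ j → cycles₅ (4 + k) (suc j)) (λ j → P (cycles₅ k j))) ⟩
  1 + (sumBelow (5 + k) (λ j → cycles₅ (4 + k) (suc j)) + sumBelow (5 + k) (λ j → P (cycles₅ k j)))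
    ≡⟨ +-assoc 1 (sumBelow (5 + k) (λ j → cycles₅ (4 + k) (suc j))) (sumBelow (5 + k) (λ j → P (cycles₅ k j))) ⟨
  sumBelow (6 + k) (cycles₅ (4 + k)) + sumBelow (5 + k) (λ j → P (cycles₅ k j))
    ≡⟨ cong₂ _+_ (roots₅-sum {4 + k} (6 + k) (<-≤-trans (m≤n+m (5 + k) 1) (m≤n*m (6 + k) 5))) sum-P ⟨
  roots₅ (4 + k) + P (roots₅ k) ∎
  where
  open ≡-Reasoning
  P : ℕ → ℕ
  P x = (4 + k) * ((3 + k) * ((2 + k) * ((1 + k) * x)))
  sum-P : P (roots₅ k) ≡ sumBelow (5 + k) (λ j → P (cycles₅ k j))
  sum-P = begin
    P (roots₅ k)
      ≡⟨ cong P (roots₅-sum (5 + k) (<-≤-trans (m≤n+m (suc k) 4) (m≤n*m (5 + k) 5))) ⟩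
    P (sumBelow (5 + k) (cycles₅ k))
      ≡⟨ sumBelow-additive (5 + k) P (cycles₅ k) (P-zero k) (P-+ k) ⟨
    sumBelow (5 + k) (λ j → P (cycles₅ k j)) ∎
    where
    P-zero : ∀ k → (4 + k) * ((3 + k) * ((2 + k) * ((1 + k) * 0))) ≡ 0
    P-zero = solve-∀
    P-+ : ∀ k x y → (4 + k) * ((3 + k) * ((2 + k) * ((1 + k) * (x + y))))
                    ≡ (4 + k) * ((3 + k) * ((2 + k) * ((1 + k) * x))) + (4 + k) * ((3 + k) * ((2 + k) * ((1 + k) * y)))
    P-+ = solve-∀

Counts-zero : Counts 0 (Periodic 5) 1
Counts-zero = record
  { elem = λ _ ()
  ; elem-∈ = λ _ ()
  ; elem-injective = λ { zero zero _ → refl }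
  ; elem-onto = λ _ _ → zero , λ ()
  }

counts-roots₅ : ∀ m → Counts m (Periodic 5) (roots₅ m)
counts-roots₅ = <-rec _ λ where
  zero    _   → Counts-zero
  (suc m) rec → subst (Counts (suc m) (Periodic 5)) (sym (roots₅-suc m))
                  (Counts-suc (rec ≤-refl) (rec (s≤s (≤-trans (m∸n≤m _ 1) (≤-trans (m∸n≤m _ 1)
                                                       (≤-trans (m∸n≤m _ 1) (m∸n≤m m 1)))))))

Counts⇒CardX : ∀ {m N} → Counts m (Periodic 5) N → CardX m N
Counts⇒CardX e =
  (λ i → permutation (elem e i) (λ x → iterate (elem e i) x 4) (elem-∈ e i) (elem-∈ e i)) ,
  elem-∈ e , elem-injective e , λ π → elem-onto e (π ⟨$⟩ʳ_)

term-exact : ∀ M a b X → X * ((a ! * b !) * 5 ^ b) ≡ M ! → term M a b ≡ X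
term-exact M a b X eq =
  trans (cong (λ z → (z / D) {{D≢0}}) (sym eq)) (m*n/n≡m X D {{D≢0}})
  where
  D = (a ! * b !) * 5 ^ b
  D≢0 = m*n≢0 (a ! * b !) (5 ^ b) {{m*n≢0 (a !) (b !) {{a !≢0}} {{b !≢0}}}} {{m^n≢0 5 b}}

term-cycles₅ : ∀ j r → term (5 * j + r) r j ≡ cycles₅ (5 * j + r) j
term-cycles₅ j r = term-exact (5 * j + r) r j _ (cycles₅-closed j r)

term-cycles₅-shift : ∀ j r → let m = 5 * j + r in
                     term (3 + m) r j ≡ (3 + m) * ((2 + m) * ((1 + m) * cycles₅ m j))
term-cycles₅-shift j r = term-exact (3 + (5 * j + r)) r j _ (trans (reassoc (3 + m) (2 + m) (1 + m) (cycles₅ m j) _)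
                                             (cong (λ x → (3 + m) * ((2 + m) * ((1 + m) * x))) (cycles₅-closed j r)))
  where
  m = 5 * j + r
  reassoc : ∀ a b c x d → a * (b * (c * x)) * d ≡ a * (b * (c * (x * d)))
  reassoc = solve-∀

private
  split-5k : ∀ k → 5 * k ≡ 2 * (2 * k) + k
  split-5k = solve-∀

  +k≤5k : ∀ a k → a + k ≤ 5 * k → a ≤ 2 * (2 * k)
  +k≤5k a k le = +-cancelʳ-≤ k a _ (subst (a + k ≤_) (split-5k k) le)

  5k<+k : ∀ a k → 5 * k < a + k → 2 * (2 * k) < a
  5k<+k a k lt = +-cancelʳ-< k _ a (subst (_< a + k) (split-5k k) lt)

  ≤ᵇ-true : ∀ {m n} → m ≤ n → (m ≤ᵇ n) ≡ true
  ≤ᵇ-true {m} {n} m≤n with m ≤ᵇ n | ≤ᵇ-reflects-≤ m n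
  ... | true  | _         = refl
  ... | false | ofⁿ m≰n = ⊥-elim (m≰n m≤n)

  if-∧-true : ∀ b₁ {b₂ b₃} {x y : ℕ} → b₂ ≡ true → b₃ ≡ true →
              (if b₁ ∧ b₂ ∧ b₃ then x else y) ≡ (if b₁ then x else y)
  if-∧-true true  refl refl = refl
  if-∧-true false _    _    = refl

  if-∧-false : ∀ b₁ b₂ {b₃} {x : ℕ} → b₃ ≡ false → (if b₁ ∧ b₂ ∧ b₃ then x else 0) ≡ 0
  if-∧-false true  true  refl = refl
  if-∧-false true  false _    = refl
  if-∧-false false _     _    = refl

  even-%2 : ∀ j → (2 * j) % 2 ≡ 0
  even-%2 j = trans (cong (_% 2) (*-comm 2 j)) (m*n%n≡0 j 2)

  odd-%2 : ∀ j → suc (2 * j) % 2 ≡ 1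
  odd-%2 j = trans (cong (λ x → suc x % 2) (*-comm 2 j)) ([m+kn]%n≡m%n 1 j 2)

  even-/2 : ∀ j → (2 * j) / 2 ≡ j
  even-/2 j = trans (cong (_/ 2) (*-comm 2 j)) (m*n/n≡m j 2)

  double-even : ∀ j k r → j + r ≡ 2 * k → 5 * k ∸ (2 * j + k) ≡ 2 * r × 2 * (2 * j + k) ≡ 5 * j + r
  double-even j k r j+r≡2k =
      trans (cong (_∸ (2 * j + k)) (trans (five k) (trans (cong (λ x → k + 2 * x) (sym j+r≡2k)) (regroup₁ j k r))))
            (m+n∸m≡n (2 * j + k) (2 * r))
    , trans (regroup₂ j k) (trans (cong (4 * j +_) (sym j+r≡2k)) (regroup₃ j r))
    where
    five : ∀ k → 5 * k ≡ k + 2 * (2 * k)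
    five = solve-∀
    regroup₁ : ∀ j k r → k + 2 * (j + r) ≡ 2 * j + k + 2 * r
    regroup₁ = solve-∀
    regroup₂ : ∀ j k → 2 * (2 * j + k) ≡ 4 * j + 2 * k
    regroup₂ = solve-∀
    regroup₃ : ∀ j r → 4 * j + (j + r) ≡ 5 * j + r
    regroup₃ = solve-∀

  double-odd : ∀ j k r → suc j + r ≡ 2 * k →
               5 * k ∸ (suc (2 * j) + k) ≡ suc (2 * r) × 2 * (suc (2 * j) + k) ≡ 3 + (5 * j + r)
  double-odd j k r 1+j+r≡2k =
      trans (cong (_∸ (suc (2 * j) + k)) (trans (five k) (trans (cong (λ x → k + 2 * x) (sym 1+j+r≡2k)) (regroup₁ j k r))))
            (m+n∸m≡n (suc (2 * j) + k) (suc (2 * r)))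
    , trans (regroup₂ j k) (trans (cong (2 + 4 * j +_) (sym 1+j+r≡2k)) (regroup₃ j r))
    where
    five : ∀ k → 5 * k ≡ k + 2 * (2 * k)
    five = solve-∀
    regroup₁ : ∀ j k r → k + 2 * (suc j + r) ≡ suc (2 * j) + k + suc (2 * r)
    regroup₁ = solve-∀
    regroup₂ : ∀ j k → 2 * (suc (2 * j) + k) ≡ 2 + 4 * j + 2 * k
    regroup₂ = solve-∀
    regroup₃ : ∀ j r → 2 + 4 * j + (suc j + r) ≡ 3 + (5 * j + r)
    regroup₃ = solve-∀

  double-even-small : ∀ j k → 2 * k < j → 2 * (2 * j + k) < 5 * j
  double-even-small j k 2k<j =
    subst₂ _<_ (sym (regroup₁ j k)) (regroup₂ j) (+-monoʳ-< (4 * j) 2k<j)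
    where
    regroup₁ : ∀ j k → 2 * (2 * j + k) ≡ 4 * j + 2 * k
    regroup₁ = solve-∀
    regroup₂ : ∀ j → 4 * j + j ≡ 5 * j
    regroup₂ = solve-∀

  double-odd-small : ∀ j k → 2 * k ≤ j → 2 * (suc (2 * j) + k) ≤ 2 + 5 * j
  double-odd-small j k 2k≤j =
    subst₂ _≤_ (sym (regroup₁ j k)) (regroup₂ j) (+-monoʳ-≤ (2 + 4 * j) 2k≤j)
    where
    regroup₁ : ∀ j k → 2 * (suc (2 * j) + k) ≡ 2 + 4 * j + 2 * k
    regroup₁ = solve-∀
    regroup₂ : ∀ j → 2 + 4 * j + j ≡ 2 + 5 * j
    regroup₂ = solve-∀

  small-vanishing : ∀ {n} j → 2 ≤ n → 2 * n ≤ 2 + 5 * j → 2 * n ∸ 3 < 5 * j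
  small-vanishing zero 2≤n le with ≤-trans (*-monoʳ-≤ 2 2≤n) le
  ... | s≤s (s≤s ())
  small-vanishing {n} (suc j) _ le = begin-strict
    2 * n ∸ 3      ≤⟨ m≤n+o⇒m∸n≤o (2 * n) 3 (subst (2 * n ≤_) (shift j) le) ⟩
    4 + 5 * j      <⟨ n<1+n (4 + 5 * j) ⟩
    5 + 5 * j      ≡⟨ *-suc 5 j ⟨
    5 * suc j      ∎
    where
    open ≤-Reasoning
    shift : ∀ j → 2 + 5 * suc j ≡ 3 + (4 + 5 * j)
    shift = solve-∀

  four≤five : ∀ j → 2 * (2 * j) ≤ 5 * j
  four≤five j = subst (_≤ 5 * j) (*-assoc 2 2 j) (*-monoˡ-≤ j {4} {5} (s≤s (s≤s (s≤s (s≤s z≤n)))))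

  twice<5*suc : ∀ n → 2 * n < 5 * suc n
  twice<5*suc n =
    ≤-<-trans (*-monoˡ-≤ n {2} {5} (s≤s (s≤s z≤n))) (subst (5 * n <_) (sym (*-suc 5 n)) (m<n+m (5 * n) {5} z<s))

summand₁-even : ∀ j k → summand₁ (2 * j + k) k ≡ cycles₅ (2 * (2 * j + k)) j
summand₁-even j k =
  trans (if-∧-true (N ≤ᵇ 5 * k) (≤ᵇ-true (m≤n+m k (2 * j))) parity) (by-size (≤ᵇ-reflects-≤ N (5 * k)))
  where
  N = 2 * j + k

  N∸k : N ∸ k ≡ 2 * j
  N∸k = m+n∸n≡m (2 * j) k

  parity : ((N ∸ k) % 2 ≡ᵇ 0) ≡ true
  parity = trans (cong (λ x → x % 2 ≡ᵇ 0) N∸k) (cong (_≡ᵇ 0) (even-%2 j))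

  by-size : ∀ {b} → Reflects (N ≤ 5 * k) b →
            (if b then term (2 * N) ((5 * k ∸ N) / 2) ((N ∸ k) / 2) else 0) ≡ cycles₅ (2 * N) j
  by-size (ofʸ N≤5k) with m≤n⇒∃[o]m+o≡n (*-cancelˡ-≤ 2 (+k≤5k (2 * j) k N≤5k))
  ... | r , j+r≡2k with double-even j k r j+r≡2k
  ... | excess , twice-N = begin
    term (2 * N) ((5 * k ∸ N) / 2) ((N ∸ k) / 2)
      ≡⟨ cong₂ (term (2 * N)) (trans (cong (_/ 2) excess) (even-/2 r)) (trans (cong (_/ 2) N∸k) (even-/2 j)) ⟩
    term (2 * N) r j
      ≡⟨ cong (λ M → term M r j) twice-N ⟩
    term (5 * j + r) r j
      ≡⟨ term-cycles₅ j r ⟩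
    cycles₅ (5 * j + r) j
      ≡⟨ cong (λ M → cycles₅ M j) twice-N ⟨
    cycles₅ (2 * N) j ∎
    where open ≡-Reasoning
  by-size (ofⁿ N≰5k) = sym (cycles₅-vanish (2 * N) j
    (double-even-small j k (*-cancelˡ-< 2 (2 * k) j (5k<+k (2 * j) k (≰⇒> N≰5k)))))

summand₁-odd : ∀ j k → summand₁ (suc (2 * j) + k) k ≡ 0
summand₁-odd j k = if-∧-false (suc (2 * j) + k ≤ᵇ 5 * k) (k ≤ᵇ suc (2 * j) + k)
  (trans (cong (λ x → x % 2 ≡ᵇ 0) (m+n∸n≡m (suc (2 * j)) k)) (cong (_≡ᵇ 0) (odd-%2 j)))

summand₂-even : ∀ j k → summand₂ (2 * j + k) k ≡ 0
summand₂-even j k = if-∧-false (2 * j + k ≤ᵇ 5 * k) (suc k ≤ᵇ 2 * j + k)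
  (trans (cong (λ x → x % 2 ≡ᵇ 1) (m+n∸n≡m (2 * j) k)) (cong (_≡ᵇ 1) (even-%2 j)))

summand₂-odd : ∀ j k → 2 ≤ suc (2 * j) + k → let n = suc (2 * j) + k in
               summand₂ n k ≡ 2 * (2 * n) * (2 * n ∸ 1) * (2 * n ∸ 2) * cycles₅ (2 * n ∸ 3) j
summand₂-odd j k 2≤N =
  trans (if-∧-true (N ≤ᵇ 5 * k) (≤ᵇ-true (s≤s (m≤n+m k (2 * j)))) parity) (by-size (≤ᵇ-reflects-≤ N (5 * k)))
  where
  N = suc (2 * j) + k
  C = 2 * (2 * N) * (2 * N ∸ 1) * (2 * N ∸ 2)

  N∸k : N ∸ k ≡ suc (2 * j)
  N∸k = m+n∸n≡m (suc (2 * j)) k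

  parity : ((N ∸ k) % 2 ≡ᵇ 1) ≡ true
  parity = trans (cong (λ x → x % 2 ≡ᵇ 1) N∸k) (cong (_≡ᵇ 1) (odd-%2 j))

  by-size : ∀ {b} → Reflects (N ≤ 5 * k) b →
            (if b then 2 * term (2 * N) ((5 * k ∸ N ∸ 1) / 2) ((N ∸ k ∸ 1) / 2) else 0) ≡ C * cycles₅ (2 * N ∸ 3) j
  by-size (ofʸ N≤5k) with m≤n⇒∃[o]m+o≡n (*-cancelˡ-< 2 j (2 * k) (+k≤5k (suc (2 * j)) k N≤5k))
  ... | r , 1+j+r≡2k with double-odd j k r 1+j+r≡2k
  ... | excess , twice-N = begin
    2 * term (2 * N) ((5 * k ∸ N ∸ 1) / 2) ((N ∸ k ∸ 1) / 2)
      ≡⟨ cong₂ (λ a b → 2 * term (2 * N) a b) (trans (cong (λ x → (x ∸ 1) / 2) excess) (even-/2 r))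
                                               (trans (cong (λ x → (x ∸ 1) / 2) N∸k) (even-/2 j)) ⟩
    2 * term (2 * N) r j
      ≡⟨ cong (λ M → 2 * term M r j) twice-N ⟩
    2 * term (3 + m) r j
      ≡⟨ cong (2 *_) (term-cycles₅-shift j r) ⟩
    2 * ((3 + m) * ((2 + m) * ((1 + m) * cycles₅ m j)))
      ≡⟨ regroup (cycles₅ m j) m ⟩
    2 * (3 + m) * (2 + m) * (1 + m) * cycles₅ m j
      ≡⟨ cong (λ M → 2 * M * (M ∸ 1) * (M ∸ 2) * cycles₅ (M ∸ 3) j) twice-N ⟨
    C * cycles₅ (2 * N ∸ 3) j ∎
    where
    open ≡-Reasoning
    m = 5 * j + r
    regroup : ∀ c m → 2 * ((3 + m) * ((2 + m) * ((1 + m) * c))) ≡ 2 * (3 + m) * (2 + m) * (1 + m) * c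
    regroup = solve-∀
  by-size (ofⁿ N≰5k) = sym (trans
    (cong (C *_) (cycles₅-vanish (2 * N ∸ 3) j (small-vanishing j 2≤N
      (double-odd-small j k (*-cancelˡ-≤ 2 (≤-pred (5k<+k (suc (2 * j)) k (≰⇒> N≰5k))))))))
    (*-zeroʳ C))

summand₁-zero : ∀ {n} → 1 ≤ n → summand₁ n 0 ≡ 0
summand₁-zero (s≤s _) = refl

summand₂-zero : ∀ {n} → 1 ≤ n → summand₂ n 0 ≡ 0
summand₂-zero (s≤s _) = refl

sumTo-summand₁ : ∀ {n} → 1 ≤ n → sumTo n (summand₁ n) ≡ roots₅ (2 * n)
sumTo-summand₁ {n} 1≤n = begin
  sumTo n (summand₁ n)
    ≡⟨ sumTo-by-parity n (summand₁ n) (cycles₅ (2 * n)) (λ _ → 0) (summand₁-zero 1≤n) even odd ⟩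
  sumBelow (suc n) (λ j → cycles₅ (2 * n) j + 0)
    ≡⟨ sumBelow-cong (suc n) (λ j _ → +-identityʳ (cycles₅ (2 * n) j)) ⟩
  sumBelow (suc n) (cycles₅ (2 * n))
    ≡⟨ roots₅-sum (suc n) (twice<5*suc n) ⟨
  roots₅ (2 * n) ∎
  where
  open ≡-Reasoning
  even : ∀ j → summand₁ n (n ∸ 2 * j) ≡ cycles₅ (2 * n) j
  even j = ∸-split n (2 * j) (summand₁ n)
    (λ k eq → subst (λ m → summand₁ m k ≡ cycles₅ (2 * m) j) eq (summand₁-even j k))
    (λ n<2j → trans (summand₁-zero 1≤n) (sym (cycles₅-vanish (2 * n) j (<-≤-trans (*-monoʳ-< 2 n<2j) (four≤five j)))))
  odd : ∀ j → summand₁ n (n ∸ suc (2 * j)) ≡ 0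
  odd j = ∸-split n (suc (2 * j)) (summand₁ n)
    (λ k eq → subst (λ m → summand₁ m k ≡ 0) eq (summand₁-odd j k))
    (λ _ → summand₁-zero 1≤n)

sumTo-summand₂ : ∀ {n} → 2 ≤ n →
                 sumTo n (summand₂ n) ≡ 2 * (2 * n) * (2 * n ∸ 1) * (2 * n ∸ 2) * roots₅ (2 * n ∸ 3)
sumTo-summand₂ {n} 2≤n = begin
  sumTo n (summand₂ n)
    ≡⟨ sumTo-by-parity n (summand₂ n) (λ _ → 0) (λ j → C * cycles₅ m j) (summand₂-zero 1≤n) even odd ⟩
  sumBelow (suc n) (λ j → C * cycles₅ m j)
    ≡⟨ sumBelow-additive (suc n) (C *_) (cycles₅ m) (*-zeroʳ C) (*-distribˡ-+ C) ⟩
  C * sumBelow (suc n) (cycles₅ m)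
    ≡⟨ cong (C *_) (roots₅-sum (suc n) (≤-<-trans (m∸n≤m (2 * n) 3) (twice<5*suc n))) ⟨
  C * roots₅ m ∎
  where
  open ≡-Reasoning
  C = 2 * (2 * n) * (2 * n ∸ 1) * (2 * n ∸ 2)
  m = 2 * n ∸ 3
  1≤n = ≤-trans (n≤1+n 1) 2≤n
  even : ∀ j → summand₂ n (n ∸ 2 * j) ≡ 0
  even j = ∸-split n (2 * j) (summand₂ n)
    (λ k eq → subst (λ n → summand₂ n k ≡ 0) eq (summand₂-even j k))
    (λ _ → summand₂-zero 1≤n)
  odd : ∀ j → summand₂ n (n ∸ suc (2 * j)) ≡ C * cycles₅ m j
  odd j = ∸-split n (suc (2 * j)) (summand₂ n)
    (λ k eq → subst (λ n → summand₂ n k ≡ 2 * (2 * n) * (2 * n ∸ 1) * (2 * n ∸ 2) * cycles₅ (2 * n ∸ 3) j) eq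
                    (summand₂-odd j k (subst (2 ≤_) (sym eq) 2≤n)))
    (λ n≤2j → trans (summand₂-zero 1≤n) (sym (trans
       (cong (C *_) (cycles₅-vanish m j (small-vanishing j 2≤n
         (≤-trans (*-monoʳ-≤ 2 (≤-pred n≤2j)) (≤-trans (four≤five j) (m≤n+m (5 * j) 2))))))
       (*-zeroʳ C))))

lemma15 : (n : ℕ) → 3 < n →
    CardX (2 * n) (sumTo n (summand₁ n))
    × (Σ[ N ∈ ℕ ] (CardX (2 * n ∸ 3) N
        × 2 * (2 * n) * (2 * n ∸ 1) * (2 * n ∸ 2) * N ≡ sumTo n (summand₂ n)))
lemma15 n 3<n =
    subst (CardX (2 * n)) (sym (sumTo-summand₁ (≤-trans (s≤s z≤n) 2≤n))) (Counts⇒CardX (counts-roots₅ (2 * n)))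
  , roots₅ (2 * n ∸ 3) , Counts⇒CardX (counts-roots₅ (2 * n ∸ 3)) , sym (sumTo-summand₂ 2≤n)
  where
  2≤n : 2 ≤ n
  2≤n = ≤-trans (n≤1+n 2) (≤-trans (n≤1+n 3) 3<n)
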